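{- Let $G$ be a graph, $f$ a Roman $\{3\}$-dominating function on $G$, and $G'$ an induced subgraph of $G$ containing a vertex $v$ such that $N_G(v)\setminus N_{G'}(v)\neq\emptyset$ and $N_G(u)=N_{G'}(u)$ for every $u\in V(G')\setminus\{v\}$. Let $f_{G'}$ denote the restriction of $f$ to $V(G')$. If $f(v)=0$, then: (i) if there is exactly one vertex $v_a\in N_G(v)\setminus N_{G'}(v)$ with $f(v_a)=1$ and $f(u)=0$ for each $u\in N_G(v)\setminus(N_{G'}(v)\cup\{v_a\})$, then $f_{G'}\in D^0(G',v)\cup D^4(G',v)$; (ii) if there is exactly one vertex $v_a\in N_G(v)\setminus N_{G'}(v)$ with $f(v_a)=2$ and $f(u)=0$ for each $u\in N_G(v)\setminus(N_{G'}(v)\cup\{v_a\})$, then $f_{G'}\in D^0(G',v)\cup D^4(G',v)\cup D^5(G',v)$; (iii) if there are exactly two vertices $v_a,v_b\in N_G(v)\setminus N_{G'}(v)$ with $f(v_a)=f(v_b)=1$ and $f(u)=0$ for each $u\in N_G(v)\setminus(N_{G'}(v)\cup\{v_a,v_b\})$, then $f_{G'}\in D^0(G',v)\cup D^4(G',v)\cup D^5(G',v)$; (iv) if there exist three vertices $v_a,v_b,v_c\in N_G(v)\setminus N_{G'}(v)$ with $f(v_a),f(v_b),f(v_c)\ge 1$, or two vertices $v_a,v_b\in N_G(v)\setminus N_{G'}(v)$ with $f(v_a)\ge 2$ and $f(v_b)\ge 1$, or a vertex $v_a\in N_G(v)\setminus N_{G'}(v)$ with $f(v_a)=3$, then $f_{G'}\in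 D^0(G',v)\cup D^4(G',v)\cup D^5(G',v)\cup D^6(G',v)$.
   Context: A Roman $\{3\}$-dominating function on a graph $H$ is a function $f:V(H)\to\{0,1,2,3\}$ such that for every vertex $u$: if $f(u)=0$ then $\sum_{w\in N_H(u)} f(w)\ge 3$, and if $f(u)=1$ then $\sum_{w\in N_H(u)} f(w)\ge 2$; here $N_H(u)$ and $N_H[u]=N_H(u)\cup\{u\}$ are the open and closed neighbourhoods. For a graph $H$, a vertex $u\in V(H)$ and a function $f:V(H)\to\{0,1,2,3\}$, let $f_{H-u}$ denote its restriction to $V(H)\setminus\{u\}$. Define the following sets of functions $f:V(H)\to\{0,1,2,3\}$: $D^0(H,u)$: $f$ is a Roman $\{3\}$-dominating function on $H$ with $f(u)=0$. $D^4(H,u)$: $f_{H-u}$ is a Roman $\{3\}$-dominating function on $H-u$, and either there is exactly one vertex $x\in N_H(u)$ with $f(x)=2$ and $f(w)=0$ for every $w\in N_H[u]\setminus\{x\}$, or there are exactly two vertices $x_1,x_2\in N_H(u)$ with $f(x_1)=f(x_2)=1$ and $f(w)=0$ for every $w\in N_H[u]\setminus\{x_1,x_2\}$. $D^5(H,u)$: $f_{H-u}$ is a Roman $\{3\}$-dominating function on $H-u$, and there is exactly one vertex $x\in N_H(u)$ with $f(x)=1$ and $f(w)=0$ for every $w\in N_H[u]\setminus\{x\}$. $D^6(H,u)$: $f_{H-u}$ is a Roman $\{3\}$-dominating function on $H-u$, and $f(w)=0$ for every $w\in N_H[u]$. -}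

module Defs where

open import Data.Bool using (Bool; true; false; _∧_; not; if_then_else_)
open import Data.Nat using (ℕ; _≤_; _≥_)
open import Data.Fin using (Fin; _≟_)
open import Data.List using (List; map; allFin)
open import Data.Nat.ListAction using (sum)
open import Data.Product using (_×_; Σ-syntax; ∃-syntax)
open import Data.Sum using (_⊎_)
open import Relation.Binary.PropositionalEquality using (_≡_; _≢_)
open import Relation.Nullary.Decidable using (⌊_⌋)

record Graph (n : ℕ) : Set where
  field
    adj     : Fin n → Fin n → Bool
    sym     : ∀ u w → adj u w ≡ adj w u
    irrefl  : ∀ u → adj u u ≡ false
open Graph public

-- A vertex subset of G; the induced subgraph G[S] is represented by S.
VSet : ℕ → Set
VSet n = Fin n → Bool

all : ∀ {n} → VSet n
all _ = true

_-ᵛ_ : ∀ {n} → VSet n → Fin n → VSet n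
(S -ᵛ u) w = S w ∧ not ⌊ w ≟ u ⌋

InN : ∀ {n} → Graph n → VSet n → Fin n → Fin n → Set
InN G S u w = (S w ≡ true) × (adj G u w ≡ true)

InNc : ∀ {n} → Graph n → VSet n → Fin n → Fin n → Set
InNc G S u w = (w ≡ u) ⊎ InN G S u w

nbSum : ∀ {n} → Graph n → VSet n → (Fin n → ℕ) → Fin n → ℕ
nbSum {n} G S f u = sum (map (λ w → if S w ∧ adj G u w then f w else 0) (allFin n))

IsR3DF : ∀ {n} → Graph n → VSet n → (Fin n → ℕ) → Set
IsR3DF G S f = ∀ u → S u ≡ true →
  (f u ≤ 3) × (f u ≡ 0 → nbSum G S f u ≥ 3) × (f u ≡ 1 → nbSum G S f u ≥ 2)

Bounded : ∀ {n} → VSet n → (Fin n → ℕ) → Set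
Bounded S f = ∀ u → S u ≡ true → f u ≤ 3

D0 : ∀ {n} → Graph n → VSet n → Fin n → (Fin n → ℕ) → Set
D0 G S u f = IsR3DF G S f × (f u ≡ 0)

D4 : ∀ {n} → Graph n → VSet n → Fin n → (Fin n → ℕ) → Set
D4 G S u f = Bounded S f × IsR3DF G (S -ᵛ u) f ×
  ( (∃[ x ] (InN G S u x × f x ≡ 2 × (∀ w → InNc G S u w → w ≢ x → f w ≡ 0)))
  ⊎ (∃[ x₁ ] ∃[ x₂ ] (x₁ ≢ x₂ × InN G S u x₁ × InN G S u x₂ × f x₁ ≡ 1 × f x₂ ≡ 1 ×
        (∀ w → InNc G S u w → w ≢ x₁ → w ≢ x₂ → f w ≡ 0))))

D5 : ∀ {n} → Graph n → VSet n → Fin n → (Fin n → ℕ) → Set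
D5 G S u f = Bounded S f × IsR3DF G (S -ᵛ u) f ×
  (∃[ x ] (InN G S u x × f x ≡ 1 × (∀ w → InNc G S u w → w ≢ x → f w ≡ 0)))

D6 : ∀ {n} → Graph n → VSet n → Fin n → (Fin n → ℕ) → Set
D6 G S u f = Bounded S f × IsR3DF G (S -ᵛ u) f × (∀ w → InNc G S u w → f w ≡ 0)

Out : ∀ {n} → Graph n → VSet n → Fin n → Fin n → Set
Out G S v w = (adj G v w ≡ true) × (S w ≡ false)

module Submission where

-- The neighbourhood sum of v in G is its sum inside G' plus its sum over the
-- outside neighbours N_G(v) ∖ N_{G'}(v), and the total is at least 3 because
-- f(v) = 0.  The inside sum alone decides the class of f_{G'}: at least 3 gives
-- D⁰, and 2, 1, 0 give D⁴, D⁵, D⁶.  Restricting to G' - v changes no other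
-- neighbourhood sum, since f(v) = 0 and N_G(u) = N_{G'}(u) for u ≠ v.  The
-- hypotheses of (i), (ii), (iii) bound the outside sum by 1, 2, 2, forcing
-- the inside sum to be at least 2, 1, 1; case (iv) needs no bound.

open import Defs hiding (sym)
open import Data.Bool using (true; false; _∧_; not; if_then_else_)
open import Data.Bool.Properties using (∧-conicalˡ)
open import Data.Nat using (ℕ; zero; suc; _+_; _≤_; _≥_; z≤n)
open import Data.Nat.Properties
  using (+-0-commutativeMonoid; +-comm; +-identityʳ; ≤-refl;
         +-mono-≤; +-monoʳ-≤; +-cancelʳ-≤; module ≤-Reasoning; m+n≡0⇒m≡0; m+n≡0⇒n≡0; suc-injective; m≤n⇒m<n∨m≡n)
open import Data.Fin using (Fin; zero; suc; _≟_)
import Data.Fin.Properties as Fin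
open import Data.List using (map; allFin; tabulate)
open import Data.List.Properties using (map-tabulate)
import Data.Nat.ListAction as List
open import Data.Vec.Functional using (Vector; tail)
open import Algebra.Properties.CommutativeMonoid.Sum +-0-commutativeMonoid
  using (sum; sum-cong-≗; sum-replicate-zero; ∑-distrib-+)
open import Data.Product using (_×_; ∃-syntax; _,_; proj₁; proj₂)
open import Data.Sum using (_⊎_; inj₁; inj₂; map₂)
open import Function using (_∘_)
open import Relation.Nullary using (yes; no; contradiction)
open import Relation.Binary.PropositionalEquality
  using (_≡_; _≢_; refl; sym; trans; cong; cong₂; subst; module ≡-Reasoning)

sum-tabulate : ∀ {n} (g : Vector ℕ n) → List.sum (tabulate g) ≡ sum g
sum-tabulate {zero}  g = refl
sum-tabulate {suc n} g = cong (g zero +_) (sum-tabulate (tail g))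

sum-map-allFin : ∀ {n} (g : Vector ℕ n) → List.sum (map g (allFin n)) ≡ sum g
sum-map-allFin g = trans (cong List.sum (map-tabulate (λ w → w) g)) (sum-tabulate g)

sum≡0⇒zero : ∀ {n} (g : Vector ℕ n) → sum g ≡ 0 → ∀ w → g w ≡ 0
sum≡0⇒zero g eq zero    = m+n≡0⇒m≡0 (g zero) eq
sum≡0⇒zero g eq (suc w) = sum≡0⇒zero (tail g) (m+n≡0⇒n≡0 (g zero) eq) w

sum≡1⇒single : ∀ {n} (g : Vector ℕ n) → sum g ≡ 1 →
  ∃[ x ] (g x ≡ 1 × (∀ w → w ≢ x → g w ≡ 0))
sum≡1⇒single {suc n} g eq with g zero in g₀
... | 0 with sum≡1⇒single (tail g) eq
...   | x , gx , rest = suc x , gx , λ { zero _ → g₀ ; (suc w) w≢ → rest w (w≢ ∘ cong suc) }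
sum≡1⇒single {suc n} g eq | 1 =
  zero , g₀ , λ { zero 0≢0 → contradiction refl 0≢0 ; (suc w) _ → sum≡0⇒zero (tail g) (suc-injective eq) w }

sum≡2⇒double : ∀ {n} (g : Vector ℕ n) → sum g ≡ 2 →
  (∃[ x ] (g x ≡ 2 × (∀ w → w ≢ x → g w ≡ 0)))
  ⊎ (∃[ x₁ ] ∃[ x₂ ] (x₁ ≢ x₂ × g x₁ ≡ 1 × g x₂ ≡ 1 × (∀ w → w ≢ x₁ → w ≢ x₂ → g w ≡ 0)))
sum≡2⇒double {suc n} g eq with g zero in g₀
... | 0 with sum≡2⇒double (tail g) eq
...   | inj₁ (x , gx , rest) =
  inj₁ (suc x , gx , λ { zero _ → g₀ ; (suc w) w≢ → rest w (w≢ ∘ cong suc) })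
...   | inj₂ (x₁ , x₂ , x₁≢x₂ , gx₁ , gx₂ , rest) =
  inj₂ (suc x₁ , suc x₂ , x₁≢x₂ ∘ Fin.suc-injective , gx₁ , gx₂ ,
        λ { zero _ _ → g₀ ; (suc w) w≢₁ w≢₂ → rest w (w≢₁ ∘ cong suc) (w≢₂ ∘ cong suc) })
sum≡2⇒double {suc n} g eq | 1 with sum≡1⇒single (tail g) (suc-injective eq)
... | x , gx , rest =
  inj₂ (zero , suc x , (λ ()) , g₀ , gx ,
        λ { zero 0≢0 _ → contradiction refl 0≢0 ; (suc w) _ w≢ → rest w (w≢ ∘ cong suc) })
sum≡2⇒double {suc n} g eq | 2 =
  inj₁ (zero , g₀ , λ { zero 0≢0 → contradiction refl 0≢0
                      ; (suc w) _ → sum≡0⇒zero (tail g) (suc-injective (suc-injective eq)) w })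

sum-zero : ∀ {n} (g : Vector ℕ n) → (∀ w → g w ≡ 0) → sum g ≡ 0
sum-zero {n} g z = trans (sum-cong-≗ z) (sum-replicate-zero n)

sum-single : ∀ {n} (g : Vector ℕ n) a → (∀ w → w ≢ a → g w ≡ 0) → sum g ≡ g a
sum-single g zero    z = trans (cong (g zero +_) (sum-zero (tail g) λ w → z (suc w) λ ())) (+-identityʳ _)
sum-single g (suc a) z rewrite z zero (λ ()) = sum-single (tail g) a λ w w≢a → z (suc w) (w≢a ∘ Fin.suc-injective)

sum-pair : ∀ {n} (g : Vector ℕ n) a b → a ≢ b → (∀ w → w ≢ a → w ≢ b → g w ≡ 0) → sum g ≡ g a + g b
sum-pair g zero    zero    a≢b z = contradiction refl a≢b
sum-pair g zero    (suc b) a≢b z =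
  cong (g zero +_) (sum-single (tail g) b λ w w≢b → z (suc w) (λ ()) (w≢b ∘ Fin.suc-injective))
sum-pair g (suc a) zero    a≢b z =
  trans (cong (g zero +_) (sum-single (tail g) a λ w w≢a → z (suc w) (w≢a ∘ Fin.suc-injective) (λ ())))
        (+-comm (g zero) (g (suc a)))
sum-pair g (suc a) (suc b) a≢b z rewrite z zero (λ ()) (λ ()) =
  sum-pair (tail g) a b (a≢b ∘ cong suc) λ w w≢a w≢b → z (suc w) (w≢a ∘ Fin.suc-injective) (w≢b ∘ Fin.suc-injective)

∁ : ∀ {n} → VSet n → VSet n
∁ S w = not (S w)

nbTerm : ∀ {n} → Graph n → VSet n → (Fin n → ℕ) → Fin n → Fin n → ℕ
nbTerm G S f u w = if S w ∧ adj G u w then f w else 0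

module _ {n} (G : Graph n) (f : Fin n → ℕ) where

  open ≡-Reasoning

  nbSum≡sum : ∀ S u → nbSum G S f u ≡ sum (nbTerm G S f u)
  nbSum≡sum S u = sum-map-allFin (nbTerm G S f u)

  nbTerm-≤ : ∀ S u w → nbTerm G S f u w ≤ f w
  nbTerm-≤ S u w with S w ∧ adj G u w
  ... | true  = ≤-refl
  ... | false = z≤n

  nbTerm-InN : ∀ S u w → InN G S u w → nbTerm G S f u w ≡ f w
  nbTerm-InN S u w (Sw , uw) rewrite Sw | uw = refl

  nbTerm≡suc⇒InN : ∀ S u w {k} → nbTerm G S f u w ≡ suc k → InN G S u w × f w ≡ suc k
  nbTerm≡suc⇒InN S u w eq with S w | adj G u w
  ... | true | true = (refl , refl) , eq

  nbTerm-vanish : ∀ S u w → (InN G S u w → f w ≡ 0) → nbTerm G S f u w ≡ 0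
  nbTerm-vanish S u w z with S w | adj G u w
  ... | true  | true  = z (refl , refl)
  ... | true  | false = refl
  ... | false | _     = refl

  nbSum-split : ∀ S u → nbSum G all f u ≡ nbSum G S f u + nbSum G (∁ S) f u
  nbSum-split S u = begin
    nbSum G all f u                                    ≡⟨ nbSum≡sum all u ⟩
    sum (nbTerm G all f u)                             ≡⟨ sum-cong-≗ split ⟩
    sum (λ w → nbTerm G S f u w + nbTerm G (∁ S) f u w) ≡⟨ ∑-distrib-+ (nbTerm G S f u) (nbTerm G (∁ S) f u) ⟩
    sum (nbTerm G S f u) + sum (nbTerm G (∁ S) f u)     ≡⟨ sym (cong₂ _+_ (nbSum≡sum S u) (nbSum≡sum (∁ S) u)) ⟩
    nbSum G S f u + nbSum G (∁ S) f u                  ∎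
    where
    split : ∀ w → nbTerm G all f u w ≡ nbTerm G S f u w + nbTerm G (∁ S) f u w
    split w with S w | adj G u w
    ... | true  | true  = sym (+-identityʳ (f w))
    ... | true  | false = refl
    ... | false | true  = refl
    ... | false | false = refl

  nbSum-full : ∀ T u → (∀ w → adj G u w ≡ true → T w ≡ false → f w ≡ 0) → nbSum G T f u ≡ nbSum G all f u
  nbSum-full T u missing = begin
    nbSum G T f u          ≡⟨ nbSum≡sum T u ⟩
    sum (nbTerm G T f u)   ≡⟨ sum-cong-≗ agree ⟩
    sum (nbTerm G all f u) ≡⟨ sym (nbSum≡sum all u) ⟩
    nbSum G all f u        ∎
    where
    agree : ∀ w → nbTerm G T f u w ≡ nbTerm G all f u w
    agree w with T w in Tw | adj G u w in uw
    ... | true  | _     = refl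
    ... | false | false = refl
    ... | false | true  = sym (missing w uw Tw)

module Restriction {n} (G : Graph n) (f : Fin n → ℕ) (S : VSet n) (v : Fin n)
  (hf : IsR3DF G all f) (Sv : S v ≡ true)
  (closed : ∀ u → S u ≡ true → u ≢ v → ∀ w → adj G u w ≡ true → S w ≡ true)
  (fv≡0 : f v ≡ 0) where

  removed-is-v : ∀ {w} → S w ≡ true → (S -ᵛ v) w ≡ false → w ≡ v
  removed-is-v {w} Sw out with w ≟ v | S w
  ... | yes w≡v | _     = w≡v
  ... | no _    | true  = contradiction out λ ()
  ... | no _    | false = contradiction Sw λ ()

  v∉-ᵛ : (S -ᵛ v) v ≢ true
  v∉-ᵛ with v ≟ v
  ... | no v≢v = contradiction refl v≢v
  ... | yes _ with S v
  ...   | true  = λ ()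
  ...   | false = λ ()

  nbSum-S : ∀ u → S u ≡ true → u ≢ v → nbSum G S f u ≡ nbSum G all f u
  nbSum-S u Su u≢v = nbSum-full G f S u λ w uw Sw →
    contradiction (trans (sym Sw) (closed u Su u≢v w uw)) λ ()

  nbSum-S-v : ∀ u → (S -ᵛ v) u ≡ true → u ≢ v → nbSum G (S -ᵛ v) f u ≡ nbSum G all f u
  nbSum-S-v u u∈ u≢v = nbSum-full G f (S -ᵛ v) u missing
    where
    missing : ∀ w → adj G u w ≡ true → (S -ᵛ v) w ≡ false → f w ≡ 0
    missing w uw out rewrite removed-is-v (closed u (∧-conicalˡ _ _ u∈) u≢v w uw) out = fv≡0

  isR3DF-on : ∀ T → (∀ u → T u ≡ true → u ≢ v → nbSum G T f u ≡ nbSum G all f u) →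
    (T v ≡ true → nbSum G T f v ≥ 3) → IsR3DF G T f
  isR3DF-on T same atV u Tu with u ≟ v
  ... | yes refl = proj₁ (hf u refl) , (λ _ → atV Tu) , λ fu≡1 → contradiction (trans (sym fv≡0) fu≡1) λ ()
  ... | no u≢v rewrite same u Tu u≢v = hf u refl

  isR3DF-S-v : IsR3DF G (S -ᵛ v) f
  isR3DF-S-v = isR3DF-on (S -ᵛ v) nbSum-S-v (λ v∈ → contradiction v∈ v∉-ᵛ)

  bounded : Bounded S f
  bounded u _ = proj₁ (hf u refl)

  Nc-vanish : ∀ w → InNc G S v w → nbTerm G S f v w ≡ 0 → f w ≡ 0
  Nc-vanish w (inj₁ refl) _   = fv≡0
  Nc-vanish w (inj₂ w∈) t≡0 = trans (sym (nbTerm-InN G f S v w w∈)) t≡0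

  inner≡sum : ∀ {m} → nbSum G S f v ≡ m → sum (nbTerm G S f v) ≡ m
  inner≡sum = trans (sym (nbSum≡sum G f S v))

  D0-of : 3 ≤ nbSum G S f v → D0 G S v f
  D0-of ≥3 = isR3DF-on S nbSum-S (λ _ → ≥3) , fv≡0

  D4-of : nbSum G S f v ≡ 2 → D4 G S v f
  D4-of eq with sum≡2⇒double (nbTerm G S f v) (inner≡sum eq)
  ... | inj₁ (x , tx , rest) with nbTerm≡suc⇒InN G f S v x tx
  ...   | x∈ , fx = bounded , isR3DF-S-v , inj₁ (x , x∈ , fx , λ w w∈ w≢x → Nc-vanish w w∈ (rest w w≢x))
  D4-of eq | inj₂ (x₁ , x₂ , x₁≢x₂ , tx₁ , tx₂ , rest)
    with nbTerm≡suc⇒InN G f S v x₁ tx₁ | nbTerm≡suc⇒InN G f S v x₂ tx₂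
  ... | x₁∈ , fx₁ | x₂∈ , fx₂ = bounded , isR3DF-S-v ,
    inj₂ (x₁ , x₂ , x₁≢x₂ , x₁∈ , x₂∈ , fx₁ , fx₂ , λ w w∈ w≢₁ w≢₂ → Nc-vanish w w∈ (rest w w≢₁ w≢₂))

  D5-of : nbSum G S f v ≡ 1 → D5 G S v f
  D5-of eq with sum≡1⇒single (nbTerm G S f v) (inner≡sum eq)
  ... | x , tx , rest with nbTerm≡suc⇒InN G f S v x tx
  ...   | x∈ , fx = bounded , isR3DF-S-v , x , x∈ , fx , λ w w∈ w≢x → Nc-vanish w w∈ (rest w w≢x)

  D6-of : nbSum G S f v ≡ 0 → D6 G S v f
  D6-of eq = bounded , isR3DF-S-v , λ w w∈ → Nc-vanish w w∈ (sum≡0⇒zero (nbTerm G S f v) (inner≡sum eq) w)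

  classify≥2 : 2 ≤ nbSum G S f v → D0 G S v f ⊎ D4 G S v f
  classify≥2 h with m≤n⇒m<n∨m≡n h
  ... | inj₁ 3≤ = inj₁ (D0-of 3≤)
  ... | inj₂ 2≡ = inj₂ (D4-of (sym 2≡))

  classify≥1 : 1 ≤ nbSum G S f v → D0 G S v f ⊎ D4 G S v f ⊎ D5 G S v f
  classify≥1 h with m≤n⇒m<n∨m≡n h
  ... | inj₁ 2≤ = map₂ inj₁ (classify≥2 2≤)
  ... | inj₂ 1≡ = inj₂ (inj₂ (D5-of (sym 1≡)))

  classify : D0 G S v f ⊎ D4 G S v f ⊎ D5 G S v f ⊎ D6 G S v f
  classify with m≤n⇒m<n∨m≡n (z≤n {nbSum G S f v})
  ... | inj₁ 1≤ = map₂ (map₂ inj₁) (classify≥1 1≤)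
  ... | inj₂ 0≡ = inj₂ (inj₂ (inj₂ (D6-of (sym 0≡))))

  InN∁⇒Out : ∀ {w} → InN G (∁ S) v w → Out G S v w
  InN∁⇒Out {w} (S∁w , vw) with S w
  ... | false = vw , refl
  ... | true  = contradiction S∁w λ ()

  outer-vanish : ∀ w → (Out G S v w → f w ≡ 0) → nbTerm G (∁ S) f v w ≡ 0
  outer-vanish w z = nbTerm-vanish G f (∁ S) v w (z ∘ InN∁⇒Out)

  outer≤₁ : ∀ a {c} → f a ≡ c → (∀ u → Out G S v u → u ≢ a → f u ≡ 0) → nbSum G (∁ S) f v ≤ c
  outer≤₁ a {c} fa≡c others = begin
    nbSum G (∁ S) f v        ≡⟨ nbSum≡sum G f (∁ S) v ⟩
    sum (nbTerm G (∁ S) f v) ≡⟨ sum-single _ a (λ w w≢a → outer-vanish w λ w-out → others w w-out w≢a) ⟩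
    nbTerm G (∁ S) f v a     ≤⟨ nbTerm-≤ G f (∁ S) v a ⟩
    f a                      ≡⟨ fa≡c ⟩
    c                        ∎
    where open ≤-Reasoning

  outer≤₂ : ∀ a b → a ≢ b → f a ≡ 1 → f b ≡ 1 → (∀ u → Out G S v u → u ≢ a → u ≢ b → f u ≡ 0) →
    nbSum G (∁ S) f v ≤ 2
  outer≤₂ a b a≢b fa≡1 fb≡1 others = begin
    nbSum G (∁ S) f v                             ≡⟨ nbSum≡sum G f (∁ S) v ⟩
    sum (nbTerm G (∁ S) f v)                      ≡⟨ sum-pair _ a b a≢b (λ w w≢a w≢b →
                                                       outer-vanish w λ w-out → others w w-out w≢a w≢b) ⟩
    nbTerm G (∁ S) f v a + nbTerm G (∁ S) f v b   ≤⟨ +-mono-≤ (nbTerm-≤ G f (∁ S) v a) (nbTerm-≤ G f (∁ S) v b) ⟩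
    f a + f b                                     ≡⟨ cong₂ _+_ fa≡1 fb≡1 ⟩
    2                                             ∎
    where open ≤-Reasoning

  inner-lower : ∀ k c → k + c ≡ 3 → nbSum G (∁ S) f v ≤ c → k ≤ nbSum G S f v
  inner-lower k c k+c≡3 outer≤c = +-cancelʳ-≤ c k (nbSum G S f v) (begin
    k + c                                 ≡⟨ k+c≡3 ⟩
    3                                     ≤⟨ subst (3 ≤_) (nbSum-split G f S v) (proj₁ (proj₂ (hf v refl)) fv≡0) ⟩
    nbSum G S f v + nbSum G (∁ S) f v     ≤⟨ +-monoʳ-≤ (nbSum G S f v) outer≤c ⟩
    nbSum G S f v + c                     ∎)
    where open ≤-Reasoning

lemma5 : ∀ {n} (G : Graph n) (f : Fin n → ℕ) (S : VSet n) (v : Fin n) →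
    IsR3DF G all f →
    S v ≡ true →
    (∃[ w ] Out G S v w) →
    (∀ u → S u ≡ true → u ≢ v → ∀ w → adj G u w ≡ true → S w ≡ true) →
    f v ≡ 0 →
    ((∃[ a ] (Out G S v a × f a ≡ 1 × (∀ u → Out G S v u → u ≢ a → f u ≡ 0))) →
        D0 G S v f ⊎ D4 G S v f)
    × ((∃[ a ] (Out G S v a × f a ≡ 2 × (∀ u → Out G S v u → u ≢ a → f u ≡ 0))) →
        D0 G S v f ⊎ D4 G S v f ⊎ D5 G S v f)
    × ((∃[ a ] ∃[ b ] (a ≢ b × Out G S v a × Out G S v b × f a ≡ 1 × f b ≡ 1 ×
          (∀ u → Out G S v u → u ≢ a → u ≢ b → f u ≡ 0))) →
        D0 G S v f ⊎ D4 G S v f ⊎ D5 G S v f)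
    × (((∃[ a ] ∃[ b ] ∃[ c ] (a ≢ b × a ≢ c × b ≢ c ×
            Out G S v a × Out G S v b × Out G S v c × f a ≥ 1 × f b ≥ 1 × f c ≥ 1))
        ⊎ (∃[ a ] ∃[ b ] (a ≢ b × Out G S v a × Out G S v b × f a ≥ 2 × f b ≥ 1))
        ⊎ (∃[ a ] (Out G S v a × f a ≡ 3))) →
        D0 G S v f ⊎ D4 G S v f ⊎ D5 G S v f ⊎ D6 G S v f)
lemma5 G f S v hf Sv _ closed fv≡0 =
    (λ (a , _ , fa≡1 , others) → classify≥2 (inner-lower 2 1 refl (outer≤₁ a fa≡1 others)))
  , (λ (a , _ , fa≡2 , others) → classify≥1 (inner-lower 1 2 refl (outer≤₁ a fa≡2 others)))
  , (λ (a , b , a≢b , _ , _ , fa≡1 , fb≡1 , others) →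
       classify≥1 (inner-lower 1 2 refl (outer≤₂ a b a≢b fa≡1 fb≡1 others)))
  , (λ _ → classify)
  where open Restriction G f S v hf Sv closed fv≡0
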